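{- Let $d \geq 3$ and $1 \leq r < \frac d2$ be integers. Then, as formal power series in $x$ and $q$, $$f_{d,r}(x) = \left(1 + xq^r + xq^{d-r}\right) f_{d,r}\left(xq^d\right) + xq^d\left(1 - xq^d\right) f_{d,r}\left(xq^{2d}\right),$$ where $f_{d,r}(x) = f_{d,r}(x;q)$.
   Context: Let $f_{d,r}(x;q) := \sum_{\lambda} x^{\ell(\lambda)} q^{|\lambda|}$, where the sum runs over all partitions $\lambda = (\lambda_1 > \dots > \lambda_k)$ (including the empty partition) such that every part satisfies $\lambda_i \equiv 0, \pm r \pmod d$, $\lambda_i - \lambda_{i+1} \geq d$ for $1\le i<k$, and $\lambda_i - \lambda_{i+1} > d$ whenever $d \mid \lambda_i$ ($1\le i<k$); here $\ell(\lambda) = k$ is the number of parts and $|\lambda|$ the sum of the parts. -}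

module Defs where

open import Data.Nat using (ℕ; zero; suc; _+_; _*_; _∸_; _≤_; _<_; _<?_; _≤?_)
open import Data.Nat.Divisibility using (_∣?_)
import Data.Nat.Divisibility as ℕᵈ
open import Data.Integer as ℤ using (ℤ; +_; ∣_∣)
open import Data.Integer.Divisibility using (_∣_)
open import Data.List using (List; []; _∷_; length; filter; map; concatMap)
open import Data.Nat.ListAction using (sum)
open import Data.Product using (_×_; _,_)
open import Data.Sum using (_⊎_; inj₁; inj₂)
open import Data.Unit using (⊤; tt)
open import Relation.Nullary using (Dec; yes; no; ¬_)
open import Relation.Nullary.Decidable using (_×-dec_; _⊎-dec_; _→-dec_)
open import Relation.Binary.PropositionalEquality using (_≡_)
import Data.Nat.Properties as ℕₚ

-- The partitions counted by f_{d,r}.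
-- A partition λ = (λ₁ > … > λₖ) is represented as the list λ₁ ∷ … ∷ λₖ ∷ [].

CongMod : ℕ → ℤ → ℤ → Set
CongMod d m a = (+ d) ∣ (m ℤ.- a)

AllowedPart : ℕ → ℕ → ℕ → Set
AllowedPart d r m =
  0 < m × (CongMod d (+ m) (+ 0) ⊎ CongMod d (+ m) (+ r) ⊎ CongMod d (+ m) (ℤ.- (+ r)))

GapOK : ℕ → ℕ → ℕ → Set
GapOK d a b = (d ≤ a ∸ b × b < a) × ((+ d ∣ + a) → d < a ∸ b)

Valid : ℕ → ℕ → List ℕ → Set
Valid d r [] = ⊤
Valid d r (a ∷ []) = AllowedPart d r a
Valid d r (a ∷ b ∷ λs) = AllowedPart d r a × GapOK d a b × Valid d r (b ∷ λs)

allowed? : ∀ d r m → Dec (AllowedPart d r m)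
allowed? d r m = (0 <? m) ×-dec ((d ∣? _) ⊎-dec ((d ∣? _) ⊎-dec (d ∣? _)))

gap? : ∀ d a b → Dec (GapOK d a b)
gap? d a b = ((d ≤? a ∸ b) ×-dec (b <? a)) ×-dec ((d ∣? a) →-dec (d <? a ∸ b))

valid? : ∀ d r λs → Dec (Valid d r λs)
valid? d r [] = yes tt
valid? d r (a ∷ []) = allowed? d r a
valid? d r (a ∷ b ∷ λs) = allowed? d r a ×-dec (gap? d a b ×-dec valid? d r (b ∷ λs))

-- all lists of length k with entries in {1, …, n}
-- (every partition of n with k parts occurs among them)
range1 : ℕ → List ℕ
range1 zero = []
range1 (suc n) = suc n ∷ range1 n

lists : ℕ → ℕ → List (List ℕ)
lists zero n = [] ∷ []
lists (suc k) n = concatMap (λ a → map (a ∷_) (lists k n)) (range1 n)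

-- Formal power series in x and q with integer coefficients:
-- F k n is the coefficient of x^k q^n.

FPS : Set
FPS = ℕ → ℕ → ℤ

_⊕_ : FPS → FPS → FPS
(F ⊕ G) k n = F k n ℤ.+ G k n

_⊖_ : FPS → FPS → FPS
(F ⊖ G) k n = F k n ℤ.- G k n

infixl 6 _⊕_ _⊖_

mulQ : ℕ → FPS → FPS
mulQ zero F k n = F k n
mulQ (suc b) F k zero = + 0
mulQ (suc b) F k (suc n) = mulQ b F k n

mulX : ℕ → FPS → FPS
mulX zero F k n = F k n
mulX (suc a) F zero n = + 0
mulX (suc a) F (suc k) n = mulX a F k n

mono : ℕ → ℕ → FPS → FPS
mono a b F = mulX a (mulQ b F)

-- substitution x ↦ x q^j :  F(x q^j) has coefficient [x^k q^n] = [x^k q^(n - j k)] F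
substXQ : ℕ → FPS → FPS
substXQ j F k n = mulQ (j * k) F k n

-- f_{d,r}(x;q): coefficient of x^k q^n is the number of valid partitions
-- with k parts and sum n
f : ℕ → ℕ → FPS
f d r k n = + length (filter (λ λs → (sum λs ℕₚ.≟ n) ×-dec valid? d r λs) (lists k n))

-- Sort the partitions by their smallest part λₖ.  If λₖ > d, subtracting d from every part is a
-- bijection onto all partitions counted by f (a shift by a multiple of d preserves residues and
-- gaps); this gives f(xq^d).  Otherwise λₖ ∈ {r, d - r, d}, and deleting it leaves a partition
-- whose parts are > d, ≥ 2d - r, resp. > 2d; this gives xq^r f(xq^d), xq^(d-r) times the series
-- of partitions with parts ≥ 2d - r, and xq^d f(xq^(2d)).  A partition with all parts > d either
-- has all parts ≥ 2d - r or has smallest part d + r, the only allowed part in between, and deleting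
-- that part leaves parts > 2d.  So the middle term is xq^(d-r) (f(xq^d) - xq^(d+r) f(xq^(2d))).
module Submission where

open import Defs
open import Data.Nat using (ℕ; _≤_; _<_; _*_; _∸_)
open import Relation.Binary.PropositionalEquality using (_≡_)

open import Data.Nat using (zero; suc; _+_; z≤n; s≤s; _≤?_; _<?_; >-nonZero)
open import Data.Nat.Properties
open import Data.Nat.Divisibility using (_∣_; _∣0; divides; ∣⇒≤; ∣-refl; ∣m+n∣m⇒∣n; ∣m∣n⇒∣m+n)
open import Data.Nat.ListAction using (sum)
open import Data.Nat.ListAction.Properties using (sum-++)
open import Data.Nat.Tactic.RingSolver using (solve-∀)
open import Data.Integer using (ℤ; +_)
import Data.Integer as ℤ
import Data.Integer.Properties as ℤ
open import Data.Integer.Divisibility.Signed using ()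
  renaming ( _∣_ to _∣ˢ_; ∣ᵤ⇒∣ to ∣⇒∣ˢ; ∣⇒∣ᵤ to ∣ˢ⇒∣; ∣-refl to ∣ˢ-refl
           ; ∣m∣n⇒∣m+n to ∣ˢ-+; ∣m+n∣m⇒∣n to ∣ˢ-∸)
import Data.Integer.Tactic.RingSolver as ℤSolver
open import Data.Maybe using (just)
import Data.Maybe.Properties as Maybe
open import Data.List
  using (List; []; _∷_; _++_; _∷ʳ_; [_]; last; initLast; _∷ʳ′_; length; map; filter; applyDownFrom)
open import Data.List.Properties
  using (filter-none; map-injective; ∷ʳ-injectiveˡ; length-map; length-++; ∷-injectiveˡ; ∷-injectiveʳ)
open import Data.List.Membership.Propositional using (_∈_)
open import Data.List.Membership.Propositional.Properties
  using (∈-map⁺; ∈-map⁻; ∈-concatMap⁺; ∈-concatMap⁻; ∈-filter⁺; ∈-filter⁻; ∈-∃++; ∈-applyDownFrom⁺)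
open import Data.List.Relation.Unary.All as All using (All; []; _∷_)
import Data.List.Relation.Unary.All.Properties as All
open import Data.List.Relation.Unary.Any as Any using (here; there)
open import Data.List.Relation.Unary.AllPairs as AllPairs using ([]; _∷_)
import Data.List.Relation.Unary.AllPairs.Properties as AllPairs
open import Data.List.Relation.Unary.Unique.Propositional using (Unique)
import Data.List.Relation.Unary.Unique.Propositional.Properties as Unique
open import Data.List.Relation.Binary.Disjoint.Propositional using (Disjoint)
import Data.List.Relation.Binary.Subset.Propositional as List
open import Data.List.Relation.Binary.Permutation.Propositional.Properties using (shift; ∈-resp-↭; ↭-length)
import Data.Product as Product
open import Data.Product using (_×_; _,_; proj₁; proj₂; ∃-syntax)
import Data.Sum as Sum
open import Data.Sum using (_⊎_; inj₁; inj₂)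
open import Data.Empty using (⊥; ⊥-elim)
open import Data.Unit using (tt)
open import Function.Base using (_∘_)
open import Function.Bundles using (_⇔_; Equivalence; mk⇔)
open import Function.Definitions using (Injective)
open import Level using (0ℓ)
open import Relation.Nullary using (yes; no)
open import Relation.Nullary.Decidable using (_×-dec_)
open import Relation.Unary using (Pred; Decidable; _≐_; _⊆_; _∩_; _∪_; ∅)
open import Relation.Unary.Properties using (_∪?_)
open import Relation.Binary.PropositionalEquality
  using (refl; sym; trans; cong; cong₂; subst; _≢_; module ≡-Reasoning)

-- Lists

unique-⊆⇒length-≤ : {A : Set} {xs ys : List A} → Unique xs → xs List.⊆ ys → length xs ≤ length ys
unique-⊆⇒length-≤ {xs = []} _ _ = z≤n
unique-⊆⇒length-≤ {xs = x ∷ xs} {ys} (x∉xs ∷ !xs) xs⊆ys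
  with as , bs , refl ← ∈-∃++ (xs⊆ys (here refl)) = begin
    suc (length xs)         ≤⟨ s≤s (unique-⊆⇒length-≤ !xs xs⊆as++bs) ⟩
    suc (length (as ++ bs)) ≡⟨ ↭-length (shift x as bs) ⟨
    length (as ++ x ∷ bs)   ∎
  where
  open ≤-Reasoning
  xs⊆as++bs : xs List.⊆ as ++ bs
  xs⊆as++bs y∈xs with ∈-resp-↭ (shift x as bs) (xs⊆ys (there y∈xs))
  ... | here y≡x = ⊥-elim (All.lookup x∉xs y∈xs (sym y≡x))
  ... | there y∈as++bs = y∈as++bs

range1≡applyDownFrom : ∀ n → range1 n ≡ applyDownFrom suc n
range1≡applyDownFrom zero = refl
range1≡applyDownFrom (suc n) = cong (suc n ∷_) (range1≡applyDownFrom n)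

range1-unique : ∀ n → Unique (range1 n)
range1-unique n = subst Unique (sym (range1≡applyDownFrom n))
  (Unique.applyDownFrom⁺₁ suc n (λ j<i _ 1+i≡1+j → <⇒≢ j<i (sym (suc-injective 1+i≡1+j))))

∈-range1⁺ : ∀ {i n} → i < n → suc i ∈ range1 n
∈-range1⁺ {n = n} i<n = subst (_ ∈_) (sym (range1≡applyDownFrom n)) (∈-applyDownFrom⁺ suc i<n)

lists-unique : ∀ k n → Unique (lists k n)
lists-unique zero n = [] ∷ []
lists-unique (suc k) n = Unique.concat⁺
  (All.map⁺ (All.universal (λ a → Unique.map⁺ ∷-injectiveʳ (lists-unique k n)) (range1 n)))
  (AllPairs.map⁺ (AllPairs.map disjoint (range1-unique n)))
  where
  disjoint : ∀ {a b} → a ≢ b → Disjoint (map (a ∷_) (lists k n)) (map (b ∷_) (lists k n))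
  disjoint a≢b (p , q) with _ , _ , refl ← ∈-map⁻ _ p | _ , _ , eq ← ∈-map⁻ _ q = a≢b (∷-injectiveˡ eq)

∈-lists⁺ : ∀ {t k n} → length t ≡ k → All (λ a → 0 < a × a ≤ n) t → t ∈ lists k n
∈-lists⁺ {[]} refl [] = here refl
∈-lists⁺ {suc i ∷ t} {n = n} refl ((_ , i<n) ∷ bounds) =
  ∈-concatMap⁺ (λ a → map (a ∷_) (lists (length t) n))
    (Any.map (λ { refl → ∈-map⁺ (suc i ∷_) (∈-lists⁺ refl bounds) }) (∈-range1⁺ {n = n} i<n))

∈-lists⁻ : ∀ {t k n} → t ∈ lists k n → length t ≡ k
∈-lists⁻ {k = zero} (here refl) = refl
∈-lists⁻ {k = suc k} {n} t∈
  with _ , t∈a∷ ← Any.satisfied (∈-concatMap⁻ (λ a → map (a ∷_) (lists k n)) {xs = range1 n} t∈)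
  with _ , t′∈ , refl ← ∈-map⁻ _ t∈a∷ = cong suc (∈-lists⁻ t′∈)

parts≤sum : ∀ t → All (_≤ sum t) t
parts≤sum [] = []
parts≤sum (a ∷ t) = m≤m+n a (sum t) ∷ All.map (λ a≤ → ≤-trans a≤ (m≤n+m (sum t) a)) (parts≤sum t)

*-length≤sum : ∀ {c t} → All (c ≤_) t → c * length t ≤ sum t
*-length≤sum {c} [] = ≤-reflexive (*-zeroʳ c)
*-length≤sum {c} {a ∷ t} (c≤a ∷ bounds) =
  subst (_≤ a + sum t) (sym (*-suc c (length t))) (+-mono-≤ c≤a (*-length≤sum bounds))

sum-map-+ : ∀ c t → sum (map (_+_ c) t) ≡ c * length t + sum t
sum-map-+ c [] = sym (trans (+-identityʳ (c * 0)) (*-zeroʳ c))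
sum-map-+ c (a ∷ t) = begin
  c + a + sum (map (_+_ c) t)      ≡⟨ cong (_+_ (c + a)) (sum-map-+ c t) ⟩
  c + a + (c * length t + sum t)   ≡⟨ regroup c a (c * length t) (sum t) ⟩
  c + c * length t + (a + sum t)   ≡⟨ cong (_+ (a + sum t)) (*-suc c (length t)) ⟨
  c * suc (length t) + (a + sum t) ∎
  where
  open ≡-Reasoning
  regroup : ∀ c a x y → c + a + (x + y) ≡ c + x + (a + y)
  regroup = solve-∀

above⇒map-+ : ∀ {c t} → All (c <_) t → ∃[ x ] All (0 <_) x × map (_+_ c) x ≡ t
above⇒map-+ [] = [] , [] , refl
above⇒map-+ {c} {a ∷ t} (c<a ∷ bounds) with x , pos , refl ← above⇒map-+ bounds =
  a ∸ c ∷ x , m<n⇒0<n∸m c<a ∷ pos , cong (_∷ map (_+_ c) x) (m+[n∸m]≡n (<⇒≤ c<a))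

sum-∷ʳ : ∀ t s → sum (t ∷ʳ s) ≡ s + sum t
sum-∷ʳ t s = trans (sum-++ t [ s ]) (trans (cong (_+_ (sum t)) (+-identityʳ s)) (+-comm (sum t) s))

length-∷ʳ : ∀ (t : List ℕ) s → length (t ∷ʳ s) ≡ suc (length t)
length-∷ʳ t s = trans (length-++ t) (+-comm (length t) 1)

last-∷ʳ : ∀ {A : Set} (t : List A) s → last (t ∷ʳ s) ≡ just s
last-∷ʳ [] s = refl
last-∷ʳ (a ∷ []) s = refl
last-∷ʳ (a ∷ b ∷ t) s = last-∷ʳ (b ∷ t) s

last≡just⇒∷ʳ : ∀ {A : Set} {u : List A} {s} → last u ≡ just s → ∃[ t ] u ≡ t ∷ʳ s
last≡just⇒∷ʳ {u = u} last≡s with initLast u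
... | t ∷ʳ′ a with refl ← trans (sym (last-∷ʳ t a)) last≡s = t , refl

-- Counting lists of given length and sum

module _ {A : Set} {P Q : Pred A 0ℓ} (P? : Decidable P) (Q? : Decidable Q) where

  length-filter-cong : P ≐ Q → ∀ xs → length (filter P? xs) ≡ length (filter Q? xs)
  length-filter-cong _ [] = refl
  length-filter-cong P≐Q@(P⊆Q , Q⊆P) (x ∷ xs) with P? x | Q? x
  ... | yes _ | yes _ = cong suc (length-filter-cong P≐Q xs)
  ... | no _  | no _  = length-filter-cong P≐Q xs
  ... | yes p | no ¬q = ⊥-elim (¬q (P⊆Q p))
  ... | no ¬p | yes q = ⊥-elim (¬p (Q⊆P q))

  length-filter-∪ : P ∩ Q ⊆ ∅ → ∀ xs →
    length (filter (P? ∪? Q?) xs) ≡ length (filter P? xs) + length (filter Q? xs)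
  length-filter-∪ _ [] = refl
  length-filter-∪ P⊥Q (x ∷ xs) with P? x | Q? x
  ... | no _  | no _  = length-filter-∪ P⊥Q xs
  ... | yes _ | no _  = cong suc (length-filter-∪ P⊥Q xs)
  ... | no _  | yes _ = trans (cong suc (length-filter-∪ P⊥Q xs)) (sym (+-suc _ _))
  ... | yes p | yes q = ⊥-elim (P⊥Q (p , q))

module _ {P : Pred (List ℕ) 0ℓ} (P? : Decidable P) where

  counted : ℕ → ℕ → List (List ℕ)
  counted k n = filter (λ t → (sum t ≟ n) ×-dec P? t) (lists k n)

  count : ℕ → ℕ → ℕ
  count k n = length (counted k n)

  counted-unique : ∀ k n → Unique (counted k n)
  counted-unique k n = Unique.filter⁺ _ (lists-unique k n)

  ∈-counted⁺ : ∀ {t k n} → All (0 <_) t → length t ≡ k → sum t ≡ n → P t → t ∈ counted k n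
  ∈-counted⁺ {t} pos len refl p = ∈-filter⁺ _ (∈-lists⁺ len (All.zip (pos , parts≤sum t))) (refl , p)

  ∈-counted⁻ : ∀ {t k n} → t ∈ counted k n → length t ≡ k × sum t ≡ n × P t
  ∈-counted⁻ t∈ with t∈lists , sum≡ , p ← ∈-filter⁻ (λ t → (sum t ≟ _) ×-dec P? t) t∈ =
    ∈-lists⁻ t∈lists , sum≡ , p

  count-≡0 : ∀ {k n} → (∀ {t} → length t ≡ k → sum t ≡ n → P t → ⊥) → count k n ≡ 0
  count-≡0 {k} {n} none = cong length
    (filter-none (λ t → (sum t ≟ n) ×-dec P? t) {lists k n}
      (All.tabulate λ t∈ (sum≡ , p) → none (∈-lists⁻ t∈) sum≡ p))

Shaped : ℕ → ℕ → List ℕ → Set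
Shaped k n t = length t ≡ k × sum t ≡ n

module _ {P Q : Pred (List ℕ) 0ℓ} (P? : Decidable P) (Q? : Decidable Q) where

  count-cong : P ≐ Q → ∀ k n → count P? k n ≡ count Q? k n
  count-cong (P⊆Q , Q⊆P) k n =
    length-filter-cong _ _ (Product.map₂ P⊆Q , Product.map₂ Q⊆P) (lists k n)

  count-∪ : P ∩ Q ⊆ ∅ → ∀ k n → count (P? ∪? Q?) k n ≡ count P? k n + count Q? k n
  count-∪ P⊥Q k n = trans (length-filter-cong _ (S∩P? ∪? S∩Q?) distrib (lists k n))
                          (length-filter-∪ S∩P? S∩Q? (λ ((_ , p) , (_ , q)) → P⊥Q (p , q)) (lists k n))
    where
    S∩P? = λ t → (sum t ≟ n) ×-dec P? t
    S∩Q? = λ t → (sum t ≟ n) ×-dec Q? t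
    distrib : (λ t → sum t ≡ n × (P t ⊎ Q t)) ≐ (λ t → (sum t ≡ n × P t) ⊎ (sum t ≡ n × Q t))
    distrib = (λ { (s , inj₁ p) → inj₁ (s , p) ; (s , inj₂ q) → inj₂ (s , q) })
            , (λ { (inj₁ (s , p)) → s , inj₁ p ; (inj₂ (s , q)) → s , inj₂ q })

  bijection⇒count-≡ : ∀ {k n k′ n′} (g : List ℕ → List ℕ) → Injective _≡_ _≡_ g →
    P ⊆ All (0 <_) → Q ⊆ All (0 <_) →
    (∀ {x} → Shaped k n x → P x → Shaped k′ n′ (g x) × Q (g x)) →
    (∀ {y} → Shaped k′ n′ y → Q y → ∃[ x ] (Shaped k n x × P x) × g x ≡ y) →
    count P? k n ≡ count Q? k′ n′
  bijection⇒count-≡ {k} {n} {k′} {n′} g g-injective P⇒pos Q⇒pos to from = ≤-antisym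
    (subst (_≤ count Q? k′ n′) (length-map g xs) (unique-⊆⇒length-≤ gxs-unique gxs⊆ys))
    (subst (count Q? k′ n′ ≤_) (length-map g xs) (unique-⊆⇒length-≤ (counted-unique Q? k′ n′) ys⊆gxs))
    where
    xs = counted P? k n
    gxs-unique : Unique (map g xs)
    gxs-unique = Unique.map⁺ g-injective (counted-unique P? k n)
    gxs⊆ys : map g xs List.⊆ counted Q? k′ n′
    gxs⊆ys y∈ with x , x∈ , refl ← ∈-map⁻ g y∈ with len , sum≡ , p ← ∈-counted⁻ P? x∈
      with (len′ , sum≡′) , q ← to (len , sum≡) p = ∈-counted⁺ Q? (Q⇒pos q) len′ sum≡′ q
    ys⊆gxs : counted Q? k′ n′ List.⊆ map g xs
    ys⊆gxs y∈ with len , sum≡ , q ← ∈-counted⁻ Q? y∈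
      with x , ((len′ , sum≡′) , p) , refl ← from (len , sum≡) q =
      ∈-map⁺ g (∈-counted⁺ P? (P⇒pos p) len′ sum≡′ p)

-- Formal power series

infix 4 _≈_

_≈_ : FPS → FPS → Set
F ≈ G = ∀ k n → F k n ≡ G k n

series : {P : Pred (List ℕ) 0ℓ} → Decidable P → FPS
series P? k n = + count P? k n

series-∪ : ∀ {P Q : Pred (List ℕ) 0ℓ} (P? : Decidable P) (Q? : Decidable Q) →
  P ∩ Q ⊆ ∅ → series (P? ∪? Q?) ≈ series P? ⊕ series Q?
series-∪ P? Q? P⊥Q k n = trans (cong +_ (count-∪ P? Q? P⊥Q k n)) (ℤ.pos-+ (count P? k n) (count Q? k n))

mulQ-< : ∀ b (F : FPS) k {n} → n < b → mulQ b F k n ≡ + 0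
mulQ-< (suc b) F k {zero} _ = refl
mulQ-< (suc b) F k {suc n} (s≤s n<b) = mulQ-< b F k n<b

mulQ-+ : ∀ b (F : FPS) k m → mulQ b F k (b + m) ≡ F k m
mulQ-+ zero F k m = refl
mulQ-+ (suc b) F k m = mulQ-+ b F k m

mulQ-unique : ∀ b (F : FPS) k (X : ℕ → ℤ) →
  (∀ m → X (b + m) ≡ F k m) → (∀ {n} → n < b → X n ≡ + 0) → ∀ n → X n ≡ mulQ b F k n
mulQ-unique b F k X shifted vanishing n with b ≤? n
... | yes b≤n = subst (λ n → X n ≡ mulQ b F k n) (m+[n∸m]≡n b≤n)
                      (trans (shifted (n ∸ b)) (sym (mulQ-+ b F k (n ∸ b))))
... | no b≰n = trans (vanishing (≰⇒> b≰n)) (sym (mulQ-< b F k (≰⇒> b≰n)))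

mulQ-cong : ∀ b {F G} → F ≈ G → mulQ b F ≈ mulQ b G
mulQ-cong zero F≈G k n = F≈G k n
mulQ-cong (suc b) F≈G k zero = refl
mulQ-cong (suc b) F≈G k (suc n) = mulQ-cong b F≈G k n

mulX-cong : ∀ a {F G} → F ≈ G → mulX a F ≈ mulX a G
mulX-cong zero F≈G k n = F≈G k n
mulX-cong (suc a) F≈G zero n = refl
mulX-cong (suc a) F≈G (suc k) n = mulX-cong a F≈G k n

mulQ-⊕ : ∀ b F G → mulQ b (F ⊕ G) ≈ mulQ b F ⊕ mulQ b G
mulQ-⊕ zero F G k n = refl
mulQ-⊕ (suc b) F G k zero = refl
mulQ-⊕ (suc b) F G k (suc n) = mulQ-⊕ b F G k n

mulX-⊕ : ∀ a F G → mulX a (F ⊕ G) ≈ mulX a F ⊕ mulX a G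
mulX-⊕ zero F G k n = refl
mulX-⊕ (suc a) F G zero n = refl
mulX-⊕ (suc a) F G (suc k) n = mulX-⊕ a F G k n

mulQ-mulQ : ∀ a b F → mulQ a (mulQ b F) ≈ mulQ (a + b) F
mulQ-mulQ zero b F k n = refl
mulQ-mulQ (suc a) b F k zero = refl
mulQ-mulQ (suc a) b F k (suc n) = mulQ-mulQ a b F k n

mulQ-mulX₁ : ∀ b F → mulQ b (mulX 1 F) ≈ mulX 1 (mulQ b F)
mulQ-mulX₁ zero F k n = refl
mulQ-mulX₁ (suc b) F zero zero = refl
mulQ-mulX₁ (suc b) F zero (suc n) = mulQ-mulX₁ b F zero n
mulQ-mulX₁ (suc b) F (suc k) zero = refl
mulQ-mulX₁ (suc b) F (suc k) (suc n) = mulQ-mulX₁ b F (suc k) n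

mono-cong : ∀ a b {F G} → F ≈ G → mono a b F ≈ mono a b G
mono-cong a b F≈G = mulX-cong a (mulQ-cong b F≈G)

mono-⊕ : ∀ a b F G → mono a b (F ⊕ G) ≈ mono a b F ⊕ mono a b G
mono-⊕ a b F G k n = trans (mulX-cong a (mulQ-⊕ b F G) k n) (mulX-⊕ a (mulQ b F) (mulQ b G) k n)

mono₁-mono₁ : ∀ a b F → mono 1 a (mono 1 b F) ≈ mono 2 (a + b) F
mono₁-mono₁ a b F zero n = refl
mono₁-mono₁ a b F (suc k) n = trans (mulQ-mulX₁ a (mulQ b F) k n) (mulX-cong 1 (mulQ-mulQ a b F) k n)

-- Congruences and gaps

+[m+n]-i≡+m+[+n-i] : ∀ m n i → + (m + n) ℤ.- i ≡ + m ℤ.+ (+ n ℤ.- i)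
+[m+n]-i≡+m+[+n-i] m n i = trans (cong (ℤ._- i) (ℤ.pos-+ m n)) (ℤ.+-assoc (+ m) (+ n) (ℤ.- i))

+m-[-+n]≡+[m+n] : ∀ m n → + m ℤ.- ℤ.- + n ≡ + (m + n)
+m-[-+n]≡+[m+n] m n = trans (cong (ℤ._+_ (+ m)) (ℤ.neg-involutive (+ n))) (sym (ℤ.pos-+ m n))

congMod-+ : ∀ {d c} a t → d ∣ c → CongMod d (+ a) t → CongMod d (+ (c + a)) t
congMod-+ {d} {c} a t d∣c d∣a-t = ∣ˢ⇒∣ (subst (+ d ∣ˢ_) (sym (+[m+n]-i≡+m+[+n-i] c a t))
  (∣ˢ-+ (∣⇒∣ˢ {+ d} {+ c} d∣c) (∣⇒∣ˢ {+ d} {+ a ℤ.- t} d∣a-t)))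

congMod-∸ : ∀ {d c} a t → d ∣ c → CongMod d (+ (c + a)) t → CongMod d (+ a) t
congMod-∸ {d} {c} a t d∣c d∣c+a-t = ∣ˢ⇒∣ (∣ˢ-∸ {n = + a ℤ.- t}
  (subst (+ d ∣ˢ_) (+[m+n]-i≡+m+[+n-i] c a t) (∣⇒∣ˢ d∣c+a-t)) (∣⇒∣ˢ {+ d} {+ c} d∣c))

<⇒∃+ : ∀ {c a} → c < a → ∃[ b ] 0 < b × c + b ≡ a
<⇒∃+ {c} {a} c<a = a ∸ c , m<n⇒0<n∸m c<a , m+[n∸m]≡n (<⇒≤ c<a)

m∣n∧0<n<m+m⇒n≡m : ∀ {d x} → d ∣ x → 0 < x → x < d + d → x ≡ d
m∣n∧0<n<m+m⇒n≡m (divides zero refl) () _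
m∣n∧0<n<m+m⇒n≡m {d} (divides 1 refl) _ _ = +-identityʳ d
m∣n∧0<n<m+m⇒n≡m {d} (divides (suc (suc q)) refl) _ x<d+d =
  ⊥-elim (<⇒≱ x<d+d (+-monoʳ-≤ d (m≤m+n d (q * d))))

multiples-<⇒+≤ : ∀ {d c a} → d ∣ c → d ∣ a → c < a → c + d ≤ a
multiples-<⇒+≤ d∣c d∣a c<a with b , 0<b , refl ← <⇒∃+ c<a =
  +-monoʳ-≤ _ (∣⇒≤ {{>-nonZero 0<b}} (∣m+n∣m⇒∣n d∣a d∣c))

gapOK⇒+≤ : ∀ {d a s} → GapOK d a s → d + s ≤ a
gapOK⇒+≤ ((d≤a∸s , s<a) , _) = m≤o∸n⇒m+n≤o _ (<⇒≤ s<a) d≤a∸s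

gapOK-∣⇒+≤ : ∀ {d a s} → GapOK d a s → d ∣ a → suc d + s ≤ a
gapOK-∣⇒+≤ ((_ , s<a) , wide) d∣a = m≤o∸n⇒m+n≤o _ (<⇒≤ s<a) (wide d∣a)

+≤⇒gapOK : ∀ {d a s} → 0 < d → d + s ≤ a → (d ∣ a → suc d + s ≤ a) → GapOK d a s
+≤⇒gapOK {d} {a} {s} 0<d d+s≤a wide =
  (m+n≤o⇒m≤o∸n d d+s≤a , <-≤-trans (m<n+m s 0<d) d+s≤a) , λ d∣a → m+n≤o⇒m≤o∸n (suc d) (wide d∣a)

gapOK-trans : ∀ {d a b c} → 0 < d → GapOK d a b → GapOK d b c → GapOK d a c
gapOK-trans {d} {a} {b} {c} 0<d gap-ab gap-bc = +≤⇒gapOK 0<d (≤-trans (n≤1+n _) 1+d+c≤a) (λ _ → 1+d+c≤a)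
  where
  1+d+c≤a : suc d + c ≤ a
  1+d+c≤a = begin
    suc d + c   ≤⟨ +-monoˡ-≤ (d + c) 0<d ⟩
    d + (d + c) ≤⟨ +-monoʳ-≤ d (gapOK⇒+≤ gap-bc) ⟩
    d + b       ≤⟨ gapOK⇒+≤ gap-ab ⟩
    a           ∎
    where open ≤-Reasoning

gapOK-+ : ∀ {d c a b} → d ∣ c → GapOK d a b → GapOK d (c + a) (c + b)
gapOK-+ {c = c} {a} {b} d∣c ((d≤a∸b , b<a) , wide) rewrite [m+n]∸[m+o]≡n∸o c a b =
  (d≤a∸b , +-monoʳ-< c b<a) , λ d∣c+a → wide (∣m+n∣m⇒∣n d∣c+a d∣c)

gapOK-∸ : ∀ {d c a b} → d ∣ c → GapOK d (c + a) (c + b) → GapOK d a b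
gapOK-∸ {c = c} {a} {b} d∣c ((d≤a∸b , c+b<c+a) , wide) rewrite [m+n]∸[m+o]≡n∸o c a b =
  (d≤a∸b , +-cancelˡ-< c b a c+b<c+a) , λ d∣a → wide (∣m∣n⇒∣m+n d∣c d∣a)

-- Partitions counted by f d r

module Partitions (d r : ℕ) where

  allowed-+ : ∀ {c a} → d ∣ c → AllowedPart d r a → AllowedPart d r (c + a)
  allowed-+ {c} {a} d∣c (0<a , residue) = <-≤-trans 0<a (m≤n+m a c) ,
    Sum.map (congMod-+ a (+ 0) d∣c) (Sum.map (congMod-+ a (+ r) d∣c) (congMod-+ a (ℤ.- + r) d∣c)) residue

  allowed-∸ : ∀ {c a} → d ∣ c → 0 < a → AllowedPart d r (c + a) → AllowedPart d r a
  allowed-∸ {c} {a} d∣c 0<a (_ , residue) = 0<a ,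
    Sum.map (congMod-∸ a (+ 0) d∣c) (Sum.map (congMod-∸ a (+ r) d∣c) (congMod-∸ a (ℤ.- + r) d∣c)) residue

  valid⇒allowed : ∀ {t} → Valid d r t → All (AllowedPart d r) t
  valid⇒allowed {[]} _ = []
  valid⇒allowed {a ∷ []} allowed = allowed ∷ []
  valid⇒allowed {a ∷ b ∷ t} (allowed , _ , valid) = allowed ∷ valid⇒allowed valid

  valid⇒positive : ∀ {t} → Valid d r t → All (0 <_) t
  valid⇒positive valid = All.map proj₁ (valid⇒allowed valid)

  valid-map-+⁺ : ∀ {c} → d ∣ c → ∀ {t} → Valid d r t → Valid d r (map (_+_ c) t)
  valid-map-+⁺ d∣c {[]} _ = tt
  valid-map-+⁺ d∣c {a ∷ []} allowed = allowed-+ d∣c allowed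
  valid-map-+⁺ d∣c {a ∷ b ∷ t} (allowed , gap , valid) =
    allowed-+ d∣c allowed , gapOK-+ d∣c gap , valid-map-+⁺ d∣c valid

  valid-map-+⁻ : ∀ {c} → d ∣ c → ∀ {t} → All (0 <_) t → Valid d r (map (_+_ c) t) → Valid d r t
  valid-map-+⁻ d∣c {[]} _ _ = tt
  valid-map-+⁻ d∣c {a ∷ []} (0<a ∷ _) allowed = allowed-∸ d∣c 0<a allowed
  valid-map-+⁻ d∣c {a ∷ b ∷ t} (0<a ∷ pos) (allowed , gap , valid) =
    allowed-∸ d∣c 0<a allowed , gapOK-∸ d∣c gap , valid-map-+⁻ d∣c pos valid

  valid-∷ʳ⁺ : ∀ {t s} → Valid d r t → AllowedPart d r s → All (λ a → GapOK d a s) t → Valid d r (t ∷ʳ s)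
  valid-∷ʳ⁺ {[]} _ allowed-s _ = allowed-s
  valid-∷ʳ⁺ {a ∷ []} allowed allowed-s (gap ∷ []) = allowed , gap , allowed-s
  valid-∷ʳ⁺ {a ∷ b ∷ t} (allowed , gap , valid) allowed-s (_ ∷ gaps) =
    allowed , gap , valid-∷ʳ⁺ valid allowed-s gaps

  valid-∷ʳ⁻ : 0 < d → ∀ {t s} → Valid d r (t ∷ʳ s) →
    Valid d r t × AllowedPart d r s × All (λ a → GapOK d a s) t
  valid-∷ʳ⁻ 0<d {[]} allowed-s = tt , allowed-s , []
  valid-∷ʳ⁻ 0<d {a ∷ []} (allowed , gap , allowed-s) = allowed , allowed-s , gap ∷ []
  valid-∷ʳ⁻ 0<d {a ∷ b ∷ t} (allowed , gap-ab , valid) with valid-∷ʳ⁻ 0<d {b ∷ t} valid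
  ... | valid′ , allowed-s , gaps@(gap-b ∷ _) =
    (allowed , gap-ab , valid′) , allowed-s , gapOK-trans 0<d gap-ab gap-b ∷ gaps

  ValidFrom : ℕ → Pred (List ℕ) 0ℓ
  ValidFrom b t = Valid d r t × All (b ≤_) t

  validFrom? : ∀ b → Decidable (ValidFrom b)
  validFrom? b t = valid? d r t ×-dec All.all? (b ≤?_) t

  ValidEnding : ℕ → Pred (List ℕ) 0ℓ
  ValidEnding s t = Valid d r t × last t ≡ just s

  validEnding? : ∀ s → Decidable (ValidEnding s)
  validEnding? s t = valid? d r t ×-dec Maybe.≡-dec _≟_ (last t) (just s)

  valid-last⇒bounded : 0 < d → ∀ {u a b} → Valid d r u → last u ≡ just a → b ≤ a → All (b ≤_) u
  valid-last⇒bounded 0<d {u} {a} valid last≡a b≤a with t , refl ← last≡just⇒∷ʳ {u = u} last≡a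
    with _ , _ , gaps ← valid-∷ʳ⁻ 0<d valid =
    All.∷ʳ⁺ (All.map (λ gap → ≤-trans b≤a (<⇒≤ (proj₂ (proj₁ gap)))) gaps) b≤a

  validFrom∩validEnding : ∀ {b s} → s < b → ValidFrom b ∩ ValidEnding s ⊆ ∅
  validFrom∩validEnding s<b {u} ((_ , bounds) , (_ , last≡s)) with t , refl ← last≡just⇒∷ʳ {u = u} last≡s =
    <⇒≱ s<b (proj₂ (All.∷ʳ⁻ bounds))

  validEnding∩validEnding : ∀ {s s′} → s ≢ s′ → ValidEnding s ∩ ValidEnding s′ ⊆ ∅
  validEnding∩validEnding s≢s′ ((_ , last≡s) , (_ , last≡s′)) =
    s≢s′ (Maybe.just-injective (trans (sym last≡s) last≡s′))

  series-validFrom : ∀ {c} → d ∣ c → series (validFrom? (suc c)) ≈ substXQ c (f d r)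
  series-validFrom {c} d∣c k = mulQ-unique (c * k) (f d r) k (series (validFrom? (suc c)) k) shifted vanishing
    where
    shifted : ∀ m → series (validFrom? (suc c)) k (c * k + m) ≡ f d r k m
    shifted m = cong +_ (sym (bijection⇒count-≡ (valid? d r) (validFrom? (suc c))
      (map (_+_ c)) (map-injective (+-cancelˡ-≡ c _ _)) valid⇒positive (valid⇒positive ∘ proj₁) to from))
      where
      to : ∀ {x} → Shaped k m x → Valid d r x →
        Shaped k (c * k + m) (map (_+_ c) x) × ValidFrom (suc c) (map (_+_ c) x)
      to {x} (refl , refl) valid = (length-map _ x , sum-map-+ c x) ,
        valid-map-+⁺ d∣c valid , All.map⁺ (All.map (m<m+n c) (valid⇒positive valid))
      from : ∀ {y} → Shaped k (c * k + m) y → ValidFrom (suc c) y →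
        ∃[ x ] (Shaped k m x × Valid d r x) × map (_+_ c) x ≡ y
      from (len , sum≡) (valid , bounds) with x , pos , refl ← above⇒map-+ bounds =
        x , ((len′ , +-cancelˡ-≡ (c * k) _ _ (trans (sym sum-shifted) sum≡)) , valid-map-+⁻ d∣c pos valid) , refl
        where
        len′ : length x ≡ k
        len′ = trans (sym (length-map _ x)) len
        sum-shifted : sum (map (_+_ c) x) ≡ c * k + sum x
        sum-shifted = trans (sum-map-+ c x) (cong (λ l → c * l + sum x) len′)
    vanishing : ∀ {n} → n < c * k → series (validFrom? (suc c)) k n ≡ + 0
    vanishing {n} n<ck = cong +_ (count-≡0 (validFrom? (suc c)) {k} {n} λ { refl refl (_ , bounds) →
      <⇒≱ n<ck (*-length≤sum (All.map <⇒≤ bounds)) })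

  series-validEnding : 0 < d → ∀ {s b} → AllowedPart d r s →
    (∀ {a} → AllowedPart d r a → b ≤ a ⇔ GapOK d a s) →
    series (validEnding? s) ≈ mono 1 s (series (validFrom? b))
  series-validEnding 0<d {s} {b} allowed-s bound⇔gap zero n =
    cong +_ (count-≡0 (validEnding? s) {0} {n} λ { {[]} _ _ (_ , ()) ; {_ ∷ _} () _ _ })
  series-validEnding 0<d {s} {b} allowed-s bound⇔gap (suc k) =
    mulQ-unique s (series (validFrom? b)) k (series (validEnding? s) (suc k)) shifted vanishing
    where
    shifted : ∀ m → series (validEnding? s) (suc k) (s + m) ≡ series (validFrom? b) k m
    shifted m = cong +_ (sym (bijection⇒count-≡ (validFrom? b) (validEnding? s) (_∷ʳ s) (∷ʳ-injectiveˡ _ _)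
      (valid⇒positive ∘ proj₁) (valid⇒positive ∘ proj₁) to from))
      where
      to : ∀ {x} → Shaped k m x → ValidFrom b x → Shaped (suc k) (s + m) (x ∷ʳ s) × ValidEnding s (x ∷ʳ s)
      to {x} (refl , refl) (valid , bounds) = (length-∷ʳ x s , sum-∷ʳ x s) ,
        valid-∷ʳ⁺ valid allowed-s (All.zipWith (λ (allowed , b≤a) → Equivalence.to (bound⇔gap allowed) b≤a)
                                                (valid⇒allowed valid , bounds)) ,
        last-∷ʳ x s
      from : ∀ {y} → Shaped (suc k) (s + m) y → ValidEnding s y →
        ∃[ x ] (Shaped k m x × ValidFrom b x) × x ∷ʳ s ≡ y
      from {y} (len , sum≡) (valid , last≡s) with x , refl ← last≡just⇒∷ʳ {u = y} last≡s
        with valid′ , _ , gaps ← valid-∷ʳ⁻ 0<d valid =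
        x , ((suc-injective (trans (sym (length-∷ʳ x s)) len) , +-cancelˡ-≡ s _ _ (trans (sym (sum-∷ʳ x s)) sum≡)) ,
             valid′ , All.zipWith (λ (allowed , gap) → Equivalence.from (bound⇔gap allowed) gap)
                                  (valid⇒allowed valid′ , gaps)) ,
        refl
    vanishing : ∀ {n} → n < s → series (validEnding? s) (suc k) n ≡ + 0
    vanishing {n} n<s = cong +_ (count-≡0 (validEnding? s) {suc k} {n}
      λ { {y} _ refl (_ , last≡s) → too-small {y} last≡s n<s })
      where
      too-small : ∀ {y} → last y ≡ just s → sum y < s → ⊥
      too-small {y} last≡s sum<s with x , refl ← last≡just⇒∷ʳ {u = y} last≡s =
        <⇒≱ sum<s (subst (s ≤_) (sym (sum-∷ʳ x s)) (m≤m+n s (sum x)))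

-- The recurrence

module Recurrence (d r : ℕ) (1≤r : 1 ≤ r) (2r<d : 2 * r < d) where

  open Partitions d r

  r+r<d : r + r < d
  r+r<d = subst (_< d) (cong (_+_ r) (+-identityʳ r)) 2r<d

  r<d : r < d
  r<d = ≤-<-trans (m≤m+n r r) r+r<d

  0<d : 0 < d
  0<d = <-trans 1≤r r<d

  r<d∸r : r < d ∸ r
  r<d∸r = m+n≤o⇒m≤o∸n (suc r) r+r<d

  d∸r<d : d ∸ r < d
  d∸r<d = ∸-monoʳ-< 1≤r (<⇒≤ r<d)

  2*d≡d+d : 2 * d ≡ d + d
  2*d≡d+d = cong (_+_ d) (+-identityʳ d)

  d∣d+d : d ∣ d + d
  d∣d+d = ∣m∣n⇒∣m+n ∣-refl ∣-refl

  allowed-r : AllowedPart d r r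
  allowed-r = 1≤r , inj₂ (inj₁ (subst (λ i → d ∣ ℤ.∣ i ∣) (sym (ℤ.+-inverseʳ (+ r))) (d ∣0)))

  allowed-d∸r : AllowedPart d r (d ∸ r)
  allowed-d∸r = m<n⇒0<n∸m r<d , inj₂ (inj₂ (subst (λ i → d ∣ ℤ.∣ i ∣) (sym d∸r+r) ∣-refl))
    where
    d∸r+r : + (d ∸ r) ℤ.- ℤ.- + r ≡ + d
    d∸r+r = trans (+m-[-+n]≡+[m+n] (d ∸ r) r) (cong +_ (m∸n+n≡m (<⇒≤ r<d)))

  allowed-d : AllowedPart d r d
  allowed-d = 0<d , inj₁ (∣m∣n⇒∣m+n ∣-refl (d ∣0))

  congMod-r⇒∣ : ∀ {b} → CongMod d (+ b) (+ r) → d ∣ b + (d ∸ r)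
  congMod-r⇒∣ {b} b≡r = ∣ˢ⇒∣ (subst (+ d ∣ˢ_) shifted (∣ˢ-+ (∣⇒∣ˢ {+ d} {+ b ℤ.- + r} b≡r) ∣ˢ-refl))
    where
    regroup : ∀ b d r → (b ℤ.- r) ℤ.+ d ≡ b ℤ.+ (d ℤ.- r)
    regroup = ℤSolver.solve-∀
    shifted : (+ b ℤ.- + r) ℤ.+ + d ≡ + (b + (d ∸ r))
    shifted = begin
      (+ b ℤ.- + r) ℤ.+ + d ≡⟨ regroup (+ b) (+ d) (+ r) ⟩
      + b ℤ.+ (+ d ℤ.- + r) ≡⟨ cong (ℤ._+_ (+ b)) (trans (ℤ.m-n≡m⊖n d r) (ℤ.⊖-≥ (<⇒≤ r<d))) ⟩
      + b ℤ.+ + (d ∸ r)     ≡⟨ ℤ.pos-+ b (d ∸ r) ⟨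
      + (b + (d ∸ r))       ∎
      where open ≡-Reasoning

  congMod-−r⇒∣ : ∀ {b} → CongMod d (+ b) (ℤ.- + r) → d ∣ b + r
  congMod-−r⇒∣ {b} = subst (λ i → d ∣ ℤ.∣ i ∣) (+m-[-+n]≡+[m+n] b r)

  allowed≤d⇒d∨r∨d∸r : ∀ {b} → AllowedPart d r b → b ≤ d → b ≡ d ⊎ b ≡ r ⊎ b ≡ d ∸ r
  allowed≤d⇒d∨r∨d∸r {b} (0<b , inj₁ b≡0) b≤d =
    inj₁ (m∣n∧0<n<m+m⇒n≡m (subst (d ∣_) (+-identityʳ b) b≡0) 0<b (≤-<-trans b≤d (m<m+n d 0<d)))
  allowed≤d⇒d∨r∨d∸r {b} (0<b , inj₂ (inj₁ b≡r)) b≤d = inj₂ (inj₁ (begin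
    b                     ≡⟨ m+n∸n≡m b (d ∸ r) ⟨
    b + (d ∸ r) ∸ (d ∸ r) ≡⟨ cong (_∸ (d ∸ r)) sum≡d ⟩
    d ∸ (d ∸ r)           ≡⟨ m∸[m∸n]≡n (<⇒≤ r<d) ⟩
    r                     ∎))
    where
    open ≡-Reasoning
    sum≡d : b + (d ∸ r) ≡ d
    sum≡d = m∣n∧0<n<m+m⇒n≡m (congMod-r⇒∣ b≡r) (<-≤-trans 0<b (m≤m+n b _)) (+-mono-≤-< b≤d d∸r<d)
  allowed≤d⇒d∨r∨d∸r {b} (0<b , inj₂ (inj₂ b≡−r)) b≤d =
    inj₂ (inj₂ (trans (sym (m+n∸n≡m b r)) (cong (_∸ r) sum≡d)))
    where
    sum≡d : b + r ≡ d
    sum≡d = m∣n∧0<n<m+m⇒n≡m (congMod-−r⇒∣ b≡−r) (<-≤-trans 0<b (m≤m+n b r)) (+-mono-≤-< b≤d r<d)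

  r≤allowed : ∀ {a} → AllowedPart d r a → r ≤ a
  r≤allowed {a} allowed with a ≤? d
  ... | no a≰d = ≤-trans (<⇒≤ r<d) (<⇒≤ (≰⇒> a≰d))
  ... | yes a≤d with allowed≤d⇒d∨r∨d∸r allowed a≤d
  ...   | inj₁ refl = <⇒≤ r<d
  ...   | inj₂ (inj₁ refl) = ≤-refl
  ...   | inj₂ (inj₂ refl) = <⇒≤ r<d∸r

  multiple-<-allowed⇒+r≤ : ∀ {c a} → d ∣ c → c < a → AllowedPart d r a → c + r ≤ a
  multiple-<-allowed⇒+r≤ d∣c c<a allowed with b , 0<b , refl ← <⇒∃+ c<a =
    +-monoʳ-≤ _ (r≤allowed (allowed-∸ d∣c 0<b allowed))

  allowed-between⇒≡d+r : ∀ {a} → d < a → a < d + (d ∸ r) → AllowedPart d r a → a ≡ d + r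
  allowed-between⇒≡d+r d<a a<d+[d∸r] allowed with b , 0<b , refl ← <⇒∃+ d<a
    with b<d∸r ← +-cancelˡ-< d _ _ a<d+[d∸r]
    with allowed≤d⇒d∨r∨d∸r (allowed-∸ ∣-refl 0<b allowed) (<⇒≤ (<-trans b<d∸r d∸r<d))
  ... | inj₁ refl = ⊥-elim (<-asym b<d∸r d∸r<d)
  ... | inj₂ (inj₁ refl) = refl
  ... | inj₂ (inj₂ refl) = ⊥-elim (<-irrefl refl b<d∸r)

  gap-r : ∀ {a} → AllowedPart d r a → suc d ≤ a ⇔ GapOK d a r
  gap-r allowed = mk⇔
    (λ d<a → +≤⇒gapOK 0<d (multiple-<-allowed⇒+r≤ ∣-refl d<a allowed)
      (λ d∣a → ≤-trans (+-monoʳ-< d r<d) (multiples-<⇒+≤ ∣-refl d∣a d<a)))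
    (λ gap → <-≤-trans (m<m+n d 1≤r) (gapOK⇒+≤ gap))

  gap-d∸r : ∀ {a} → AllowedPart d r a → d + (d ∸ r) ≤ a ⇔ GapOK d a (d ∸ r)
  gap-d∸r _ = mk⇔
    (λ bound → +≤⇒gapOK 0<d bound λ d∣a →
      ≤-trans (+-monoʳ-< d d∸r<d) (multiples-<⇒+≤ ∣-refl d∣a (<-≤-trans (m<m+n d (m<n⇒0<n∸m r<d)) bound)))
    gapOK⇒+≤

  gap-d : ∀ {a} → AllowedPart d r a → suc (d + d) ≤ a ⇔ GapOK d a d
  gap-d {a} _ = mk⇔ (λ d+d<a → +≤⇒gapOK 0<d (<⇒≤ d+d<a) (λ _ → d+d<a)) strict
    where
    strict : GapOK d a d → d + d < a
    strict gap with m≤n⇒m<n∨m≡n (gapOK⇒+≤ gap)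
    ... | inj₁ d+d<a = d+d<a
    ... | inj₂ refl = ⊥-elim (<-irrefl refl (gapOK-∣⇒+≤ gap d∣d+d))

  gap-d+r : ∀ {a} → AllowedPart d r a → suc (d + d) ≤ a ⇔ GapOK d a (d + r)
  gap-d+r {a} allowed = mk⇔
    (λ d+d<a → +≤⇒gapOK 0<d (subst (_≤ a) (+-assoc d d r) (multiple-<-allowed⇒+r≤ d∣d+d d+d<a allowed))
      (λ d∣a → ≤-trans (subst (suc (d + (d + r)) ≤_) (sym (+-assoc d d d)) (+-monoʳ-< d (+-monoʳ-< d r<d)))
                       (multiples-<⇒+≤ d∣d+d d∣a d+d<a)))
    (λ gap → <-≤-trans (+-monoʳ-< d (m<m+n d 1≤r)) (gapOK⇒+≤ gap))

  classify-by-last : Valid d r ≐ ValidFrom (suc d) ∪ (ValidEnding r ∪ (ValidEnding (d ∸ r) ∪ ValidEnding d))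
  classify-by-last = classify , Sum.[ proj₁ , Sum.[ proj₁ , Sum.[ proj₁ , proj₁ ] ] ]
    where
    classify : Valid d r ⊆ ValidFrom (suc d) ∪ (ValidEnding r ∪ (ValidEnding (d ∸ r) ∪ ValidEnding d))
    classify {u} valid with initLast u
    ... | [] = inj₁ (tt , [])
    ... | t ∷ʳ′ a with _ , allowed , _ ← valid-∷ʳ⁻ 0<d valid with a ≤? d
    ...   | no a≰d = inj₁ (valid , valid-last⇒bounded 0<d valid (last-∷ʳ t a) (≰⇒> a≰d))
    ...   | yes a≤d with allowed≤d⇒d∨r∨d∸r allowed a≤d
    ...     | inj₁ refl = inj₂ (inj₂ (inj₂ (valid , last-∷ʳ t d)))
    ...     | inj₂ (inj₁ refl) = inj₂ (inj₁ (valid , last-∷ʳ t r))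
    ...     | inj₂ (inj₂ refl) = inj₂ (inj₂ (inj₁ (valid , last-∷ʳ t (d ∸ r))))

  classify-above-d : ValidFrom (suc d) ≐ ValidEnding (d + r) ∪ ValidFrom (d + (d ∸ r))
  classify-above-d = classify , Sum.[ raise-ending , raise-bound ]
    where
    classify : ValidFrom (suc d) ⊆ ValidEnding (d + r) ∪ ValidFrom (d + (d ∸ r))
    classify {u} (valid , bounds) with initLast u
    ... | [] = inj₂ (tt , [])
    ... | t ∷ʳ′ a with _ , allowed , _ ← valid-∷ʳ⁻ 0<d valid with a <? d + (d ∸ r)
    ...   | no a≮ = inj₂ (valid , valid-last⇒bounded 0<d valid (last-∷ʳ t a) (≮⇒≥ a≮))
    ...   | yes a< with refl ← allowed-between⇒≡d+r (proj₂ (All.∷ʳ⁻ bounds)) a< allowed =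
      inj₁ (valid , last-∷ʳ t (d + r))
    raise-ending : ValidEnding (d + r) ⊆ ValidFrom (suc d)
    raise-ending (valid , last≡) = valid , valid-last⇒bounded 0<d valid last≡ (m<m+n d 1≤r)
    raise-bound : ValidFrom (d + (d ∸ r)) ⊆ ValidFrom (suc d)
    raise-bound (valid , bounds) = valid , All.map (≤-trans (m<m+n d (m<n⇒0<n∸m r<d))) bounds

  series-by-last : f d r ≈ series (validFrom? (suc d))
    ⊕ (series (validEnding? r) ⊕ (series (validEnding? (d ∸ r)) ⊕ series (validEnding? d)))
  series-by-last k n = begin
    f d r k n
      ≡⟨ cong +_ (count-cong (valid? d r) (Above? ∪? (E? r ∪? (E? (d ∸ r) ∪? E? d))) classify-by-last k n) ⟩
    series (Above? ∪? (E? r ∪? (E? (d ∸ r) ∪? E? d))) k n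
      ≡⟨ series-∪ Above? _ above⊥endings k n ⟩
    series Above? k n ℤ.+ series (E? r ∪? (E? (d ∸ r) ∪? E? d)) k n
      ≡⟨ cong (ℤ._+_ (series Above? k n)) (series-∪ (E? r) _ r⊥others k n) ⟩
    series Above? k n ℤ.+ (series (E? r) k n ℤ.+ series (E? (d ∸ r) ∪? E? d) k n)
      ≡⟨ cong (λ x → series Above? k n ℤ.+ (series (E? r) k n ℤ.+ x))
              (series-∪ (E? (d ∸ r)) (E? d) (validEnding∩validEnding (<⇒≢ d∸r<d)) k n) ⟩
    series Above? k n ℤ.+ (series (E? r) k n ℤ.+ (series (E? (d ∸ r)) k n ℤ.+ series (E? d) k n)) ∎
    where
    open ≡-Reasoning
    Above? = validFrom? (suc d)
    E? = validEnding?
    above⊥endings : ValidFrom (suc d) ∩ (ValidEnding r ∪ (ValidEnding (d ∸ r) ∪ ValidEnding d)) ⊆ ∅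
    above⊥endings (above , inj₁ ending) = validFrom∩validEnding (s≤s (<⇒≤ r<d)) (above , ending)
    above⊥endings (above , inj₂ (inj₁ ending)) = validFrom∩validEnding (s≤s (<⇒≤ d∸r<d)) (above , ending)
    above⊥endings (above , inj₂ (inj₂ ending)) = validFrom∩validEnding ≤-refl (above , ending)
    r⊥others : ValidEnding r ∩ (ValidEnding (d ∸ r) ∪ ValidEnding d) ⊆ ∅
    r⊥others (ending , inj₁ ending′) = validEnding∩validEnding (<⇒≢ r<d∸r) (ending , ending′)
    r⊥others (ending , inj₂ ending′) = validEnding∩validEnding (<⇒≢ r<d) (ending , ending′)

  series-above-d : series (validFrom? (suc d)) ≈ substXQ d (f d r)
  series-above-d = series-validFrom ∣-refl

  series-above-2d : series (validFrom? (suc (d + d))) ≈ substXQ (2 * d) (f d r)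
  series-above-2d k n = trans (series-validFrom d∣d+d k n) (cong (λ c → substXQ c (f d r) k n) (sym 2*d≡d+d))

  series-above-d-split :
    series (validFrom? (suc d)) ≈ series (validEnding? (d + r)) ⊕ series (validFrom? (d + (d ∸ r)))
  series-above-d-split k n = trans
    (cong +_ (count-cong (validFrom? (suc d)) (validEnding? (d + r) ∪? validFrom? (d + (d ∸ r))) classify-above-d k n))
    (series-∪ (validEnding? (d + r)) (validFrom? (d + (d ∸ r)))
              (λ (ending , from) → validFrom∩validEnding (+-monoʳ-< d r<d∸r) (from , ending)) k n)

  series-ending-r : series (validEnding? r) ≈ mono 1 r (substXQ d (f d r))
  series-ending-r k n = trans (series-validEnding 0<d allowed-r gap-r k n) (mono-cong 1 r series-above-d k n)

  series-ending-d : series (validEnding? d) ≈ mono 1 d (substXQ (2 * d) (f d r))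
  series-ending-d k n = trans (series-validEnding 0<d allowed-d gap-d k n) (mono-cong 1 d series-above-2d k n)

  series-ending-d+r : series (validEnding? (d + r)) ≈ mono 1 (d + r) (substXQ (2 * d) (f d r))
  series-ending-d+r k n =
    trans (series-validEnding 0<d (allowed-+ ∣-refl allowed-r) gap-d+r k n) (mono-cong 1 (d + r) series-above-2d k n)

  series-ending-d∸r : ∀ k n → series (validEnding? (d ∸ r)) k n
    ≡ mono 1 (d ∸ r) (substXQ d (f d r)) k n ℤ.- mono 2 (2 * d) (substXQ (2 * d) (f d r)) k n
  series-ending-d∸r k n = begin
    E                                             ≡⟨ a+b-a≡b D E ⟨
    (D ℤ.+ E) ℤ.- D                               ≡⟨ cong (ℤ._- D) whole ⟨
    mono 1 (d ∸ r) (substXQ d (f d r)) k n ℤ.- D ∎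
    where
    open ≡-Reasoning
    a+b-a≡b : ∀ a b → a ℤ.+ b ℤ.- a ≡ b
    a+b-a≡b = ℤSolver.solve-∀
    E = series (validEnding? (d ∸ r)) k n
    D = mono 2 (2 * d) (substXQ (2 * d) (f d r)) k n
    exponent : (d ∸ r) + (d + r) ≡ 2 * d
    exponent = begin
      (d ∸ r) + (d + r) ≡⟨ cong (_+_ (d ∸ r)) (+-comm d r) ⟩
      (d ∸ r) + (r + d) ≡⟨ +-assoc (d ∸ r) r d ⟨
      (d ∸ r) + r + d   ≡⟨ cong (_+ d) (m∸n+n≡m (<⇒≤ r<d)) ⟩
      d + d             ≡⟨ 2*d≡d+d ⟨
      2 * d             ∎
    whole : mono 1 (d ∸ r) (substXQ d (f d r)) k n ≡ D ℤ.+ E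
    whole = begin
      mono 1 (d ∸ r) (substXQ d (f d r)) k n
        ≡⟨ mono-cong 1 (d ∸ r) (λ k n → trans (sym (series-above-d k n)) (series-above-d-split k n)) k n ⟩
      mono 1 (d ∸ r) (series (validEnding? (d + r)) ⊕ series (validFrom? (d + (d ∸ r)))) k n
        ≡⟨ mono-⊕ 1 (d ∸ r) _ _ k n ⟩
      mono 1 (d ∸ r) (series (validEnding? (d + r))) k n ℤ.+ mono 1 (d ∸ r) (series (validFrom? (d + (d ∸ r)))) k n
        ≡⟨ cong₂ ℤ._+_
             (trans (mono-cong 1 (d ∸ r) series-ending-d+r k n)
               (trans (mono₁-mono₁ (d ∸ r) (d + r) _ k n)
                      (cong (λ e → mono 2 e (substXQ (2 * d) (f d r)) k n) exponent)))
             (sym (series-validEnding 0<d allowed-d∸r gap-d∸r k n)) ⟩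
      D ℤ.+ E ∎

proposition2p1 : (d r : ℕ) → 3 ≤ d → 1 ≤ r → 2 * r < d →
    (k n : ℕ) →
    f d r k n ≡
      ( substXQ d (f d r)
      ⊕ mono 1 r (substXQ d (f d r))
      ⊕ mono 1 (d ∸ r) (substXQ d (f d r))
      ⊕ mono 1 d (substXQ (2 * d) (f d r))
      ⊖ mono 2 (2 * d) (substXQ (2 * d) (f d r)) ) k n
-- 3 ≤ d is implied by 1 ≤ r and 2 * r < d.
proposition2p1 d r _ 1≤r 2r<d k n = begin
  f d r k n
    ≡⟨ series-by-last k n ⟩
  series (validFrom? (suc d)) k n
    ℤ.+ (series (validEnding? r) k n ℤ.+ (series (validEnding? (d ∸ r)) k n ℤ.+ series (validEnding? d) k n))
    ≡⟨ cong₂ ℤ._+_ (series-above-d k n)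
         (cong₂ ℤ._+_ (series-ending-r k n) (cong₂ ℤ._+_ (series-ending-d∸r k n) (series-ending-d k n))) ⟩
  A ℤ.+ (B ℤ.+ ((C ℤ.- E) ℤ.+ D))
    ≡⟨ regroup A B C D E ⟩
  A ℤ.+ B ℤ.+ C ℤ.+ D ℤ.- E ∎
  where
  open Partitions d r
  open Recurrence d r 1≤r 2r<d
  open ≡-Reasoning
  A = substXQ d (f d r) k n
  B = mono 1 r (substXQ d (f d r)) k n
  C = mono 1 (d ∸ r) (substXQ d (f d r)) k n
  D = mono 1 d (substXQ (2 * d) (f d r)) k n
  E = mono 2 (2 * d) (substXQ (2 * d) (f d r)) k n
  regroup : ∀ a b c d e → a ℤ.+ (b ℤ.+ ((c ℤ.- e) ℤ.+ d)) ≡ a ℤ.+ b ℤ.+ c ℤ.+ d ℤ.- e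
  regroup = ℤSolver.solve-∀
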